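{- Let $q$ be an odd prime power and let $G=(V,E)$ be a decodable graph representation of a coding scheme over $GF(q)$. Then $b_G\le\delta_I(G)$ and $b_G\le |E|-\Gamma(G)$.
   Context: Graph representation of a coding scheme on packets $p_1,\dots,p_n\in GF(q)^\ell$ ($n\ge2$): vertices $p_1,\dots,p_n$, an edge joining $p_j,p_k$ per encoding $p_j+p_k$ ($j\ne k$), a loop at $p_j$ per encoding $p_j$ (multigraph, edges distinguishable). A spanning subgraph is decodable if the encodings of its edges determine $p_1,\dots,p_n$ uniquely. $b_G$ is the smallest $|\mathcal L|$ with $\mathcal L\subseteq E$ and $(V,E\setminus\mathcal L)$ undecodable. $d_I(v)$ is the number of edges incident with $v$ (a loop counts once) and $\delta_I(G)=\min_v d_I(v)$. $\Gamma(G)$ is the maximum, over partitions $V=V_1\cup V_2$, of the number of edges with one endpoint in $V_1$ and the other in $V_2$ (maximum cut size). -}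

module Defs where

open import Level using (Level)
open import Data.Nat using (ℕ; suc; _^_)
open import Data.Nat.Primality using (Prime)
open import Data.Bool using (Bool; true; false; not; _∨_; _xor_)
open import Data.Fin using (Fin; _≟_)
open import Data.Fin.Subset using (Subset; ∣_∣)
open import Data.Vec using (tabulate; lookup)
open import Data.Product using (Σ; ∃; _×_)
open import Relation.Nullary using (¬_; does)
open import Relation.Binary.PropositionalEquality using (_≡_; _≢_)
open import Algebra.Bundles using (CommutativeRing)

record IsField {c ℓ : Level} (R : CommutativeRing c ℓ) : Set (c Level.⊔ ℓ) where
  open CommutativeRing R
  field
    one≉zero : ¬ (1# ≈ 0#)
    inverse  : ∀ x → ¬ (x ≈ 0#) → Σ Carrier λ y → (x * y) ≈ 1#

record HasSize {c ℓ : Level} (R : CommutativeRing c ℓ) (q : ℕ) : Set (c Level.⊔ ℓ) where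
  open CommutativeRing R
  field
    enum      : Fin q → Carrier
    enum-inj  : ∀ a b → enum a ≈ enum b → a ≡ b
    enum-surj : ∀ x → Σ (Fin q) λ a → enum a ≈ x

IsOddPrimePower : ℕ → Set
IsOddPrimePower q = (∃ λ p → ∃ λ k → Prime p × q ≡ p ^ suc k) × (∃ λ r → q ≡ suc (2 Data.Nat.* r))

-- Edges of the graph representation on packets indexed by Fin n.
-- loop j  : the encoding p_j ;  link j k _ : the encoding p_j + p_k  (j ≠ k).
data Edge (n : ℕ) : Set where
  loop : Fin n → Edge n
  link : (j k : Fin n) → j ≢ k → Edge n

-- A graph representation with m (distinguishable) edges: an edge-labelling Fin m → Edge n.
Graph : ℕ → ℕ → Set
Graph n m = Fin m → Edge n

module _ {c ℓ' : Level} (R : CommutativeRing c ℓ') where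
  open CommutativeRing R

  Packet : ℕ → Set c
  Packet ℓ = Fin ℓ → Carrier

  _≋_ : ∀ {ℓ} → Packet ℓ → Packet ℓ → Set ℓ'
  u ≋ v = ∀ t → u t ≈ v t

  encode : ∀ {n ℓ} → Edge n → (Fin n → Packet ℓ) → Packet ℓ
  encode (loop j)     p t = p j t
  encode (link j k _) p t = p j t + p k t

  -- The spanning subgraph with edge set {i | keep i ≡ true} is decodable:
  -- the encodings of its edges determine p_1,…,p_n uniquely.
  Decodable : ∀ {n m} (ℓ : ℕ) → Graph n m → (Fin m → Bool) → Set (c Level.⊔ ℓ')
  Decodable {n} ℓ G keep =
    ∀ (p p' : Fin n → Packet ℓ) →
      (∀ i → keep i ≡ true → encode (G i) p ≋ encode (G i) p') →
      ∀ j → p j ≋ p' j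

  -- b is b_G: the smallest |L| with L ⊆ E and (V, E \ L) undecodable.
  IsBG : ∀ {n m} (ℓ : ℕ) → Graph n m → ℕ → Set (c Level.⊔ ℓ')
  IsBG ℓ G b =
    (Σ (Subset _) λ L → ∣ L ∣ ≡ b × ¬ Decodable ℓ G (λ i → not (lookup L i)))
    × (∀ (L : Subset _) → ¬ Decodable ℓ G (λ i → not (lookup L i)) → b Data.Nat.≤ ∣ L ∣)

-- incidence (a loop counts once)
incident : ∀ {n} → Fin n → Edge n → Bool
incident v (loop j)     = does (j ≟ v)
incident v (link j k _) = does (j ≟ v) ∨ does (k ≟ v)

degI : ∀ {n m} → Graph n m → Fin n → ℕ
degI G v = ∣ tabulate (λ i → incident v (G i)) ∣

IsMinDegI : ∀ {n m} → Graph n m → ℕ → Set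
IsMinDegI {n} G δ = (Σ (Fin n) λ v → degI G v ≡ δ) × (∀ v → δ Data.Nat.≤ degI G v)

-- an edge crosses the partition V = V₁ ∪ V₂ (V₁ = {v | S v ≡ true})
crosses : ∀ {n} → (Fin n → Bool) → Edge n → Bool
crosses S (loop _)     = false
crosses S (link j k _) = S j xor S k

cutSize : ∀ {n m} → Graph n m → (Fin n → Bool) → ℕ
cutSize G S = ∣ tabulate (λ i → crosses S (G i)) ∣

IsMaxCut : ∀ {n m} → Graph n m → ℕ → Set
IsMaxCut {n} G γ = (Σ (Fin n → Bool) λ S → cutSize G S ≡ γ) × (∀ S → cutSize G S Data.Nat.≤ γ)

module Submission where

open import Defs
open import Level using (Level)
open import Data.Nat using (ℕ; zero; suc; _≤_; _∸_)
open import Data.Nat.Properties using (≤-trans; ≤-reflexive)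
open import Data.Bool using (Bool; true; false; not; if_then_else_)
open import Data.Bool.Properties using (not-injective)
open import Data.Product using (_×_; _,_)
open import Data.Fin using (Fin; _≟_) renaming (zero to fzero)
open import Data.Fin.Subset using (∣_∣)
open import Data.Fin.Subset.Properties using (∣∁p∣≡n∸∣p∣)
open import Data.Vec using (tabulate; lookup)
open import Data.Vec.Properties using (lookup∘tabulate; tabulate-∘)
open import Data.Empty using (⊥-elim)
open import Relation.Nullary using (¬_; does; yes; no)
open import Relation.Binary.PropositionalEquality as ≡ using (_≡_; cong)
open import Algebra.Bundles using (CommutativeRing)
import Algebra.Properties.Group as GroupProperties

-- The bounds come from explicit pairs of packet assignments that no decoder can
-- tell apart. Deleting the d_I(v) edges at v leaves the all-zero assignment
-- indistinguishable from the indicator of v; deleting the edges that do not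
-- cross a cut (V₁, V₂) leaves it indistinguishable from the assignment that is
-- 1 on V₁ and -1 on V₂, since every remaining edge sees 1 + (-1) = 0.

module _ {c ℓ' : Level} (F : CommutativeRing c ℓ') where
  open CommutativeRing F
  open GroupProperties +-group using (⁻¹-injective; ε⁻¹≈ε)

  decodable-dim0 : ∀ {n m} (G : Graph n m) keep → Decodable F 0 G keep
  decodable-dim0 G keep p p' _ j ()

  bG≤-confusable : ∀ {ℓ n m b} (G : Graph n m) → IsBG F ℓ G b →
    (removed : Fin m → Bool) (p p' : Fin n → Packet F ℓ) →
    (∀ i → removed i ≡ false → _≋_ F (encode F (G i) p) (encode F (G i) p')) →
    ∀ j t → ¬ (p j t ≈ p' j t) → b ≤ ∣ tabulate removed ∣
  bG≤-confusable G (_ , minimal) removed p p' agree j t p≉p' =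
    minimal (tabulate removed) (λ decode → p≉p' (decode p p' kept-agree j t))
    where
    kept-agree : ∀ i → not (lookup (tabulate removed) i) ≡ true →
      _≋_ F (encode F (G i) p) (encode F (G i) p')
    kept-agree i kept =
      agree i (not-injective (≡.trans (cong not (≡.sym (lookup∘tabulate removed i))) kept))

  zeros : ∀ {n ℓ} → Fin n → Packet F ℓ
  zeros _ _ = 0#

  indicator : ∀ {n ℓ} → Fin n → Fin n → Packet F ℓ
  indicator v j _ = if does (j ≟ v) then 1# else 0#

  signs : ∀ {n ℓ} → (Fin n → Bool) → Fin n → Packet F ℓ
  signs S j _ = if S j then 1# else - 1#

  indicator≉0 : ¬ (1# ≈ 0#) → ∀ {n ℓ} (v : Fin n) (t : Fin ℓ) → ¬ (0# ≈ indicator v v t)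
  indicator≉0 1≉0 v t with v ≟ v
  ... | yes _  = λ 0≈1 → 1≉0 (sym 0≈1)
  ... | no v≢v = ⊥-elim (v≢v ≡.refl)

  encode-indicator-off : ∀ {n ℓ} (v : Fin n) (e : Edge n) → incident v e ≡ false →
    _≋_ F (encode F e (zeros {ℓ = ℓ})) (encode F e (indicator v))
  encode-indicator-off v (loop j) off t with j ≟ v
  ... | no _ = refl
  encode-indicator-off v (link j k _) off t with j ≟ v | k ≟ v
  ... | no _ | no _ = refl

  encode-signs-crossing : ∀ {n ℓ} (S : Fin n → Bool) (e : Edge n) → crosses S e ≡ true →
    _≋_ F (encode F e (zeros {ℓ = ℓ})) (encode F e (signs S))
  encode-signs-crossing S (link j k _) crossing t with S j | S k
  ... | true  | false = trans (+-identityˡ 0#) (sym (-‿inverseʳ 1#))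
  ... | false | true  = trans (+-identityˡ 0#) (sym (-‿inverseˡ 1#))

  -x≈0⇒x≈0 : ∀ {x} → - x ≈ 0# → x ≈ 0#
  -x≈0⇒x≈0 -x≈0 = ⁻¹-injective (trans -x≈0 (sym ε⁻¹≈ε))

  signs≉0 : ¬ (1# ≈ 0#) → ∀ {n ℓ} (S : Fin n → Bool) j (t : Fin ℓ) → ¬ (0# ≈ signs S j t)
  signs≉0 1≉0 S j t with S j
  ... | true  = λ 0≈1 → 1≉0 (sym 0≈1)
  ... | false = λ 0≈-1 → 1≉0 (-x≈0⇒x≈0 (sym 0≈-1))

uncut-size : ∀ {n m} (G : Graph n m) S →
  ∣ tabulate (λ i → not (crosses S (G i))) ∣ ≡ m ∸ cutSize G S
uncut-size G S = ≡.trans (cong ∣_∣ (tabulate-∘ not (λ i → crosses S (G i))))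
                         (∣∁p∣≡n∸∣p∣ (tabulate (λ i → crosses S (G i))))

lemma5 : ∀ {c ℓ' : Level} (F : CommutativeRing c ℓ') → IsField F →
    (q : ℕ) → IsOddPrimePower q → HasSize F q →
    (ℓ n m : ℕ) → 2 ≤ n → (G : Graph n m) →
    Decodable F ℓ G (λ _ → true) →
    (b δ γ : ℕ) → IsBG F ℓ G b → IsMinDegI G δ → IsMaxCut G γ →
    (b ≤ δ) × (b ≤ m ∸ γ)
-- Zero-length packets make every subgraph decodable, so no b_G exists.
lemma5 F _ _ _ _ zero n m _ G _ b δ γ ((_ , _ , undecodable) , _) _ _ =
  ⊥-elim (undecodable (decodable-dim0 F G _))
lemma5 F isField _ _ _ (suc ℓ) n m _ G _ b δ γ bG ((v , dv) , _) ((S , cutS) , _) =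
  ≤-trans star-bound (≤-reflexive dv) ,
  ≤-trans uncut-bound (≤-reflexive (≡.trans (uncut-size G S) (cong (m ∸_) cutS)))
  where
  open IsField isField using (one≉zero)

  star-bound : b ≤ degI G v
  star-bound = bG≤-confusable F G bG (λ i → incident v (G i)) (zeros F) (indicator F v)
    (λ i → encode-indicator-off F v (G i)) v fzero (indicator≉0 F one≉zero {ℓ = suc ℓ} v fzero)

  uncut-bound : b ≤ ∣ tabulate (λ i → not (crosses S (G i))) ∣
  uncut-bound = bG≤-confusable F G bG (λ i → not (crosses S (G i))) (zeros F) (signs F S)
    (λ i uncut → encode-signs-crossing F S (G i) (not-injective uncut))
    v fzero (signs≉0 F one≉zero {ℓ = suc ℓ} S v fzero)
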